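{- For all packed words $u,v$ with $v\ne\varepsilon$, the word $u\triangleleft_B v$ is irreducible if and only if $v$ is irreducible.
   Context: Words over positive integers; $\max(w)$ largest letter ($\max(\varepsilon)=0$), $w^{[k]}$ adds $k$ to every letter. Packed: every integer $1..\max(w)$ occurs. $u\odot v=u^{[\max(v)]}\cdot v$. A global descent of a packed word $w$ of length $n$ is $c$, $1\le c\le n-1$, with every letter of $w_1..w_c$ strictly greater than every letter of $w_{c+1}..w_n$; $w$ is irreducible if nonempty without global descent. For packed $w$: $\psi_{i^\circ}(w)$ ($1\le i\le\max(w)+1$) adds $1$ to every letter $\ge i$ and appends the letter $i$; $\psi_{i^\bullet}(w)=w\cdot i$ ($1\le i\le\max(w)$). Each nonempty packed $v$ is uniquely $\psi_{i^\alpha}(v')$ with $v'$ packed and $\alpha\in\{\circ,\bullet\}$. For packed $u$ and nonempty packed $v=\psi_{i^\alpha}(v')$, $u\triangleleft_B v=\psi_{(i+\max(u))^\alpha}(v'\odot u)$. -}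

module Defs where

open import Data.Nat using (ℕ; zero; suc; _+_; _∸_; _⊔_; _≤_; _<_; _>_; _≤ᵇ_; _≡ᵇ_)
open import Data.Bool using (Bool; true; false; if_then_else_)
open import Data.List using (List; []; _∷_; _++_; [_]; map; foldr; length; take; drop)
open import Data.Bool.ListAction using (any)
open import Data.List.Membership.Propositional using (_∈_)
open import Data.List.Relation.Unary.All using (All)
open import Data.Product using (Σ; ∃; _×_; _,_)
open import Relation.Nullary using (¬_)
open import Relation.Binary.PropositionalEquality using (_≡_)

-- Words over positive integers are lists of naturals whose letters are all ≥ 1.
Word : Set
Word = List ℕ

maxW : Word → ℕ
maxW = foldr _⊔_ 0

shift : ℕ → Word → Word
shift k = map (k +_)

Packed : Word → Set
Packed w = All (λ a → 1 ≤ a) w × (∀ j → 1 ≤ j → j ≤ maxW w → j ∈ w)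

_⊙_ : Word → Word → Word
u ⊙ v = shift (maxW v) u ++ v

GlobalDescent : Word → ℕ → Set
GlobalDescent w c =
  1 ≤ c × c < length w ×
  (∀ a b → a ∈ take c w → b ∈ drop c w → b < a)

Irreducible : Word → Set
Irreducible w = (¬ w ≡ []) × (∀ c → ¬ GlobalDescent w c)

data Kind : Set where
  ∘ • : Kind

bump : ℕ → ℕ → ℕ
bump i a = if i ≤ᵇ a then suc a else a

ψ : ℕ → Kind → Word → Word
ψ i ∘ w = map (bump i) w ++ [ i ]
ψ i • w = w ++ [ i ]

unbump : ℕ → ℕ → ℕ
unbump i a = if suc i ≤ᵇ a then a ∸ 1 else a

initLast : ℕ → Word → Word × ℕ
initLast x [] = [] , x
initLast x (y ∷ ys) with initLast y ys
... | (p , l) = (x ∷ p) , l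

-- the unique decomposition v = ψ_{i^α}(v') of a nonempty packed word x ∷ xs:
-- α = • iff the last letter i occurs earlier; otherwise α = ∘ and v' is
-- obtained by decrementing the letters > i.
decomp : ℕ → Word → Word × ℕ × Kind
decomp x xs with initLast x xs
... | (p , i) = if any (_≡ᵇ i) p then (p , i , •) else (map (unbump i) p , i , ∘)

-- u ◁_B v for nonempty v (written x ∷ xs); ε ↦ ε by convention (unused)
_◁B_ : Word → Word → Word
u ◁B [] = []
u ◁B (x ∷ xs) with decomp x xs
... | (v' , i , α) = ψ (i + maxW u) α (v' ⊙ u)

{-# OPTIONS --safe #-}

-- Write v = p·i and m = max u. Whether v = ψ_{i°}(v') or ψ_{i•}(v'), the word u ◁_B v is
-- p^[m] · u · (i+m): in the ° case the bump at i+m undoes the decrement on p^[m] and fixes u,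
-- whose letters are ≤ m. Its last letter i+m exceeds every letter of u, so no global descent
-- cuts beyond p^[m]; and at a cut c ≤ |p| the block u lies below all of
-- p^[m], so c is a global descent exactly when it is one of p·i.

module Submission where

open import Defs
open import Data.Bool using (true; false; T)
open import Data.Bool.ListAction using (any)
open import Data.List using (List; []; _∷_; _++_; _∷ʳ_; [_]; map; length; take; drop)
open import Data.List.Properties
  using (++-assoc; ++-conicalʳ; length-++; length-++-≤ˡ; length-map; map-++; map-∘; map-cong; map-id-local; take-map; drop-map)
open import Data.List.Membership.Propositional using (_∈_)
open import Data.List.Membership.Propositional.Properties using (∈-map⁺; ∈-map⁻; ∈-++⁺ˡ; ∈-++⁺ʳ; ∈-++⁻)
open import Data.List.Relation.Unary.All as All using (All; []; _∷_)
open import Data.List.Relation.Unary.All.Properties using (∷ʳ⁺; ∷ʳ⁻; ¬Any⇒All¬; take⁺)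
open import Data.List.Relation.Unary.Any using (here)
open import Data.List.Relation.Unary.Any.Properties using (any⁺)
open import Data.Nat using (ℕ; zero; suc; _+_; _∸_; _≤_; _<_; _≤ᵇ_; _≡ᵇ_; z≤n; s≤s)
open import Data.Nat.Properties
open import Data.Product using (_,_; proj₁; proj₂)
open import Data.Sum using (inj₁; inj₂)
open import Function.Bundles using (_⇔_; mk⇔; Equivalence)
open import Function.Construct.Composition using (_⇔-∘_)
open import Relation.Binary.PropositionalEquality using (_≡_; _≢_; refl; sym; trans; cong; cong₂; subst; subst₂; module ≡-Reasoning)
open import Relation.Binary.Definitions using (tri<; tri≈; tri>)
open import Relation.Nullary using (¬_; contradiction)
open import Relation.Nullary.Reflects using (ofʸ; ofⁿ)

bump-≥ : ∀ {i a} → i ≤ a → bump i a ≡ suc a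
bump-≥ {i} {a} i≤a with i ≤ᵇ a | ≤ᵇ-reflects-≤ i a
... | true  | _        = refl
... | false | ofⁿ i≰a = contradiction i≤a i≰a

bump-< : ∀ {i a} → a < i → bump i a ≡ a
bump-< {i} {a} a<i with i ≤ᵇ a | ≤ᵇ-reflects-≤ i a
... | true  | ofʸ i≤a = contradiction i≤a (<⇒≱ a<i)
... | false | _        = refl

unbump-> : ∀ {i a} → i < a → unbump i a ≡ a ∸ 1
unbump-> {i} {a} i<a with suc i ≤ᵇ a | ≤ᵇ-reflects-≤ (suc i) a
... | true  | _        = refl
... | false | ofⁿ i≮a = contradiction i<a i≮a

unbump-≤ : ∀ {i a} → a ≤ i → unbump i a ≡ a
unbump-≤ {i} {a} a≤i with suc i ≤ᵇ a | ≤ᵇ-reflects-≤ (suc i) a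
... | true  | ofʸ i<a = contradiction a≤i (<⇒≱ i<a)
... | false | _        = refl

bump-unbump : ∀ {i a} → a ≢ i → bump i (unbump i a) ≡ a
bump-unbump {i} {a} a≢i with <-cmp a i
... | tri< a<i _ _ = trans (cong (bump i) (unbump-≤ (<⇒≤ a<i))) (bump-< a<i)
... | tri≈ _ a≡i _ = contradiction a≡i a≢i
... | tri> _ _ i<a@(s≤s i≤a-1) = trans (cong (bump i) (unbump-> i<a)) (bump-≥ i≤a-1)

bump-+ : ∀ m {i a} → bump (i + m) (m + a) ≡ m + bump i a
bump-+ m {i} {a} with ≤-<-connex i a
... | inj₁ i≤a = begin
  bump (i + m) (m + a) ≡⟨ bump-≥ (subst (_≤ m + a) (+-comm m i) (+-monoʳ-≤ m i≤a)) ⟩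
  suc (m + a)          ≡⟨ sym (+-suc m a) ⟩
  m + suc a            ≡⟨ cong (m +_) (bump-≥ i≤a) ⟨
  m + bump i a         ∎
  where open ≡-Reasoning
... | inj₂ a<i = trans (bump-< (subst (m + a <_) (+-comm m i) (+-monoʳ-< m a<i)))
                      (cong (m +_) (sym (bump-< a<i)))

bump-small : ∀ {i m a} → 1 ≤ i → a ≤ m → bump (i + m) a ≡ a
bump-small {i} {m} i≥1 a≤m = bump-< (≤-<-trans a≤m (m<n+m m i≥1))

letters≤maxW : ∀ w → All (_≤ maxW w) w
letters≤maxW []      = []
letters≤maxW (a ∷ w) =
  m≤m⊔n a (maxW w) ∷ All.map (λ b≤max → ≤-trans b≤max (m≤n⊔m a (maxW w))) (letters≤maxW w)

initLast-∷ʳ : ∀ x xs → x ∷ xs ≡ proj₁ (initLast x xs) ∷ʳ proj₂ (initLast x xs)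
initLast-∷ʳ x []       = refl
initLast-∷ʳ x (y ∷ ys) with initLast y ys | initLast-∷ʳ y ys
... | _ | y∷ys≡p∷ʳl = cong (x ∷_) y∷ys≡p∷ʳl

any-≡ᵇ-false⇒≢ : ∀ {i} p → any (_≡ᵇ i) p ≡ false → All (_≢ i) p
any-≡ᵇ-false⇒≢ {i} p none =
  All.map (λ a≢ᵇi a≡i → a≢ᵇi (≡⇒≡ᵇ _ i a≡i)) (¬Any⇒All¬ p (λ occ → subst T none (any⁺ (_≡ᵇ i) occ)))

shift-unbump : ∀ m {i} p → All (_≢ i) p → map (bump (i + m)) (shift m (map (unbump i) p)) ≡ shift m p
shift-unbump m {i} p p≢i = begin
  map (bump (i + m)) (shift m (map (unbump i) p)) ≡⟨ map-∘ (map (unbump i) p) ⟨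
  map (λ a → bump (i + m) (m + a)) (map (unbump i) p) ≡⟨ map-cong (λ a → bump-+ m {i} {a}) (map (unbump i) p) ⟩
  map (λ a → m + bump i a) (map (unbump i) p) ≡⟨ map-∘ (map (unbump i) p) ⟩
  shift m (map (bump i) (map (unbump i) p)) ≡⟨ cong (shift m) (map-∘ p) ⟨
  shift m (map (λ a → bump i (unbump i a)) p) ≡⟨ cong (shift m) (map-id-local (All.map bump-unbump p≢i)) ⟩
  shift m p ∎
  where open ≡-Reasoning

◁B-initLast : ∀ u x xs → let (p , i) = initLast x xs in
  1 ≤ i → u ◁B (x ∷ xs) ≡ (shift (maxW u) p ++ u) ∷ʳ (i + maxW u)
◁B-initLast u x xs with initLast x xs
... | p , i with any (_≡ᵇ i) p in occurs
...   | true  = λ _ → refl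
...   | false = λ i≥1 → cong (_∷ʳ (i + maxW u)) (begin
  map (bump (i + m)) (shift m (map (unbump i) p) ++ u)
    ≡⟨ map-++ (bump (i + m)) (shift m (map (unbump i) p)) u ⟩
  map (bump (i + m)) (shift m (map (unbump i) p)) ++ map (bump (i + m)) u
    ≡⟨ cong₂ _++_ (shift-unbump m p (any-≡ᵇ-false⇒≢ p occurs))
                  (map-id-local (All.map (bump-small i≥1) (letters≤maxW u))) ⟩
  shift m p ++ u ∎)
  where
  m = maxW u
  open ≡-Reasoning

take-++ˡ : ∀ {c} (xs ys : Word) → c ≤ length xs → take c (xs ++ ys) ≡ take c xs
take-++ˡ {zero}  xs       ys _         = refl
take-++ˡ {suc c} (x ∷ xs) ys (s≤s c≤n) = cong (x ∷_) (take-++ˡ xs ys c≤n)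

drop-++ˡ : ∀ {c} (xs ys : Word) → c ≤ length xs → drop c (xs ++ ys) ≡ drop c xs ++ ys
drop-++ˡ {zero}  xs       ys _         = refl
drop-++ˡ {suc c} (x ∷ xs) ys (s≤s c≤n) = drop-++ˡ xs ys c≤n

length-∷ʳ : ∀ (xs : Word) {x} → length (xs ∷ʳ x) ≡ suc (length xs)
length-∷ʳ xs = trans (length-++ xs) (+-comm (length xs) 1)

∷ʳ≢[] : ∀ (xs : Word) {x} → xs ∷ʳ x ≢ []
∷ʳ≢[] xs {x} xs∷ʳx≡[] with () ← ++-conicalʳ xs [ x ] xs∷ʳx≡[]

∈-drop-∷ʳ : ∀ c (xs : Word) {x} → c < length (xs ∷ʳ x) → x ∈ drop c (xs ∷ʳ x)
∈-drop-∷ʳ zero    xs       _         = ∈-++⁺ʳ xs (here refl)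
∈-drop-∷ʳ (suc c) []       (s≤s ())
∈-drop-∷ʳ (suc c) (_ ∷ xs) (s≤s c<n) = ∈-drop-∷ʳ c xs c<n

All-take-++⇒≤ : ∀ {P : ℕ → Set} c (xs : Word) {ys} → c < length (xs ++ ys) →
  All P (take c (xs ++ ys)) → All (λ y → ¬ P y) ys → c ≤ length xs
All-take-++⇒≤ zero    xs       _         _            _          = z≤n
All-take-++⇒≤ (suc c) []       {y ∷ ys} _         (Py ∷ _)     (¬Py ∷ _) = contradiction Py ¬Py
All-take-++⇒≤ (suc c) (_ ∷ xs) (s≤s c<n) (_ ∷ Ptake) ¬Pys      = s≤s (All-take-++⇒≤ c xs c<n Ptake ¬Pys)

infix 4 _≻_

-- GlobalDescent w c unfolds to  1 ≤ c × c < length w × take c w ≻ drop c w.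
_≻_ : Word → Word → Set
xs ≻ ys = ∀ a b → a ∈ xs → b ∈ ys → b < a

≻⇒All< : ∀ {xs ys y} → xs ≻ ys → y ∈ ys → All (y <_) xs
≻⇒All< xs≻ys y∈ys = All.tabulate (λ a∈xs → xs≻ys _ _ a∈xs y∈ys)

≻-skip : ∀ {xs} ys zs ws → xs ≻ zs → (xs ≻ ys ++ zs ++ ws) ⇔ (xs ≻ ys ++ ws)
≻-skip {xs} ys zs ws xs≻zs = mk⇔ remove insert
  where
  remove : xs ≻ ys ++ zs ++ ws → xs ≻ ys ++ ws
  remove xs≻ a b a∈xs b∈ with ∈-++⁻ ys b∈
  ... | inj₁ b∈ys = xs≻ a b a∈xs (∈-++⁺ˡ b∈ys)
  ... | inj₂ b∈ws = xs≻ a b a∈xs (∈-++⁺ʳ ys (∈-++⁺ʳ zs b∈ws))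
  insert : xs ≻ ys ++ ws → xs ≻ ys ++ zs ++ ws
  insert xs≻ a b a∈xs b∈ with ∈-++⁻ ys b∈
  ... | inj₁ b∈ys = xs≻ a b a∈xs (∈-++⁺ˡ b∈ys)
  ... | inj₂ b∈zs++ws with ∈-++⁻ zs b∈zs++ws
  ...   | inj₁ b∈zs = xs≻zs a b a∈xs b∈zs
  ...   | inj₂ b∈ws = xs≻ a b a∈xs (∈-++⁺ʳ ys b∈ws)

≻-shift : ∀ m {xs ys} → (shift m xs ≻ shift m ys) ⇔ (xs ≻ ys)
≻-shift m {xs} {ys} = mk⇔ unshift reshift
  where
  unshift : shift m xs ≻ shift m ys → xs ≻ ys
  unshift h a b a∈ b∈ = +-cancelˡ-< m b a (h (m + a) (m + b) (∈-map⁺ (m +_) a∈) (∈-map⁺ (m +_) b∈))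
  reshift : xs ≻ ys → shift m xs ≻ shift m ys
  reshift h _ _ ma∈ mb∈ with ∈-map⁻ (m +_) ma∈ | ∈-map⁻ (m +_) mb∈
  ... | a , a∈ , refl | b , b∈ , refl = +-monoʳ-< m (h a b a∈ b∈)

shift-≻ : ∀ {m xs u} → All (1 ≤_) xs → All (_≤ m) u → shift m xs ≻ u
shift-≻ {m} xs≥1 u≤m _ b ma∈ b∈u with ∈-map⁻ (m +_) ma∈
... | a , a∈ , refl = ≤-<-trans (All.lookup u≤m b∈u) (m<m+n m (All.lookup xs≥1 a∈))

GlobalDescent-++-∷ʳ⇒≤ : ∀ {c} xs ys {z} → All (_≤ z) ys → GlobalDescent ((xs ++ ys) ∷ʳ z) c → c ≤ length xs
GlobalDescent-++-∷ʳ⇒≤ {c} xs ys {z} ys≤z (_ , c<n , desc) =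
  All-take-++⇒≤ c xs (subst (λ w → c < length w) assoc c<n)
    (subst (λ w → All (z <_) (take c w)) assoc (≻⇒All< desc (∈-drop-∷ʳ c (xs ++ ys) c<n)))
    (All.map ≤⇒≯ (∷ʳ⁺ ys≤z ≤-refl))
  where
  assoc : (xs ++ ys) ∷ʳ z ≡ xs ++ ys ∷ʳ z
  assoc = ++-assoc xs ys [ z ]

module _ {m k : ℕ} {B u : Word} (B≥1 : All (1 ≤_) B) (u≤m : All (_≤ m) u) where

  ≤-length-shift : ∀ {c} → c ≤ length B → c ≤ length (shift m B)
  ≤-length-shift = subst (_ ≤_) (sym (length-map (m +_) B))

  ≻-cut : ∀ {c} → c ≤ length B →
    (take c ((shift m B ++ u) ∷ʳ (k + m)) ≻ drop c ((shift m B ++ u) ∷ʳ (k + m)))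
      ⇔ (take c (B ∷ʳ k) ≻ drop c (B ∷ʳ k))
  ≻-cut {c} c≤|B|
    rewrite ++-assoc (shift m B) u [ k + m ] | +-comm k m
          | take-++ˡ (shift m B) (u ∷ʳ (m + k)) (≤-length-shift c≤|B|)
          | drop-++ˡ (shift m B) (u ∷ʳ (m + k)) (≤-length-shift c≤|B|)
          | take-map {f = m +_} c B | drop-map {f = m +_} c B
          | take-++ˡ B [ k ] c≤|B| | drop-++ˡ B [ k ] c≤|B|
    = subst (λ ws → (shift m (take c B) ≻ ws) ⇔ (take c B ≻ drop c B ∷ʳ k))
            (map-++ (m +_) (drop c B) [ k ]) (≻-shift m)
      ⇔-∘ ≻-skip (shift m (drop c B)) u [ m + k ] (shift-≻ (take⁺ c B≥1) u≤m)

  globalDescent-◁ : ∀ c → GlobalDescent ((shift m B ++ u) ∷ʳ (k + m)) c ⇔ GlobalDescent (B ∷ʳ k) c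
  globalDescent-◁ c = mk⇔ to from
    where
    to : GlobalDescent ((shift m B ++ u) ∷ʳ (k + m)) c → GlobalDescent (B ∷ʳ k) c
    to d@(c≥1 , _ , desc) =
      c≥1 , subst (c <_) (sym (length-∷ʳ B)) (s≤s c≤|B|) , Equivalence.to (≻-cut c≤|B|) desc
      where
      c≤|B| : c ≤ length B
      c≤|B| = subst (c ≤_) (length-map (m +_) B)
        (GlobalDescent-++-∷ʳ⇒≤ (shift m B) u (All.map (λ b≤m → ≤-trans b≤m (m≤n+m m k)) u≤m) d)
    from : GlobalDescent (B ∷ʳ k) c → GlobalDescent ((shift m B ++ u) ∷ʳ (k + m)) c
    from (c≥1 , c<|B∷ʳk| , desc) = c≥1 , c<|R| , Equivalence.from (≻-cut c≤|B|) desc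
      where
      c≤|B| : c ≤ length B
      c≤|B| = m<1+n⇒m≤n (subst (c <_) (length-∷ʳ B) c<|B∷ʳk|)
      c<|R| : c < length ((shift m B ++ u) ∷ʳ (k + m))
      c<|R| = subst (c <_) (sym (length-∷ʳ (shift m B ++ u)))
        (s≤s (≤-trans (≤-length-shift c≤|B|) (length-++-≤ˡ (shift m B))))

  irreducible-◁ : Irreducible ((shift m B ++ u) ∷ʳ (k + m)) ⇔ Irreducible (B ∷ʳ k)
  irreducible-◁ = mk⇔
    (λ (_ , noDescent) → ∷ʳ≢[] B , λ c d → noDescent c (Equivalence.from (globalDescent-◁ c) d))
    (λ (_ , noDescent) → ∷ʳ≢[] (shift m B ++ u) , λ c d → noDescent c (Equivalence.to (globalDescent-◁ c) d))

mainTheorem19 : (u v : List ℕ) → Packed u → Packed v → ¬ v ≡ [] →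
    Irreducible (u ◁B v) ⇔ Irreducible v
mainTheorem19 u []       _ _              v≢[] = contradiction refl v≢[]
mainTheorem19 u (x ∷ xs) _ (letters≥1 , _) _
  with p≥1 , i≥1 ← ∷ʳ⁻ (subst (All (1 ≤_)) (initLast-∷ʳ x xs) letters≥1)
  = subst₂ (λ w v → Irreducible w ⇔ Irreducible v)
      (sym (◁B-initLast u x xs i≥1)) (sym (initLast-∷ʳ x xs))
      (irreducible-◁ p≥1 (letters≤maxW u))
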